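{- Let $n,t\ge 2$ and $2\le p<n$ be integers. Let $U_1,\dots,U_t\in\mathbb{Q}^{n\times n}$ be diagonal, $P\in\mathbb{Q}^{p\times n}$ of rank $p$, $Q\in\mathbb{Q}^{n\times n}$ invertible, $W_0=PQ$ and $W_a=PU_aQ$ for $a\in[t]$. Let $E\in\mathbb{Q}^{n\times(n-p)}$ be a basis matrix of $\ker(W_0)$, $W_0^+$ a right inverse of $W_0$, $V=W_0$, $Y_a=W_0^+W_a$, and $\Delta_{ab}=VY_aY_b-VY_bY_a$ for $1\le a<b\le t$. Consider the system of linear equations over $\mathbb{Q}$ $$\Delta_{ab}=VY_bEX_a-VY_aEX_b,\qquad 1\le a<b\le t,$$ in the unknown entries of matrices $X_1,\dots,X_t\in\mathbb{Q}^{(n-p)\times n}$. This is a system of $\frac12 t(t-1)np$ linear equations in $t(n-p)n$ variables, and if it has a unique solution then Problem $\mathbb{C}$ has a unique solution for the input $\{W_a:0\le a\le t\}$ (i.e. the set $\{(u_{1,i},\dots,u_{t,i}):1\le i\le n\}$ of tuples of diagonal entries is the same for every decomposition $W_0=P'Q'$, $W_a=P'U'_aQ'$ with $P'$ of rank $p$, $Q'$ invertible and $U'_a$ diagonal). Moreover, the system has at least as many equations as variables as soon as $\frac{p}{n}\ge\frac{2}{t+1}$.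
   Context: Notation: $[t]=\{1,\dots,t\}$. Problem $\mathbb{C}$: given $W_0=PQ$ and $W_a=PU_aQ$ ($a\in[t]$) with $P\in\mathbb{Q}^{p\times n}$ of rank $p<n$, $Q\in\mathbb{Q}^{n\times n}$ invertible and $U_a$ diagonal with diagonal entries $u_{a,1},\dots,u_{a,n}$, recover the set $\{(u_{1,i},\dots,u_{t,i}):1\le i\le n\}$. -}

module Defs where

open import Data.Nat as ℕ using (ℕ; zero; suc)
open import Data.Nat.DivMod using (_/_)
open import Data.Fin using (Fin; zero; suc; _≟_)
open import Data.Rational using (ℚ; 0ℚ; 1ℚ; _+_; _*_; _-_)
open import Data.Product using (Σ; _×_; ∃-syntax)
open import Relation.Binary.PropositionalEquality using (_≡_)
open import Relation.Nullary using (yes; no)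

Mat : ℕ → ℕ → Set
Mat m n = Fin m → Fin n → ℚ

sumFin : ∀ {n} → (Fin n → ℚ) → ℚ
sumFin {zero}  f = 0ℚ
sumFin {suc n} f = f zero + sumFin (λ i → f (suc i))

infixl 7 _⊗_
_⊗_ : ∀ {m k n} → Mat m k → Mat k n → Mat m n
(A ⊗ B) i j = sumFin (λ l → A i l * B l j)

infixl 6 _⊖_
_⊖_ : ∀ {m n} → Mat m n → Mat m n → Mat m n
(A ⊖ B) i j = A i j - B i j

idM : ∀ {n} → Mat n n
idM i j with i ≟ j
... | yes _ = 1ℚ
... | no  _ = 0ℚ

zeroM : ∀ {m n} → Mat m n
zeroM _ _ = 0ℚ

diag : ∀ {n} → (Fin n → ℚ) → Mat n n
diag d i j with i ≟ j
... | yes _ = d i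
... | no  _ = 0ℚ

infix 4 _≈M_
_≈M_ : ∀ {m n} → Mat m n → Mat m n → Set
A ≈M B = ∀ i j → A i j ≡ B i j

col : ∀ {n} → (Fin n → ℚ) → Mat n 1
col v i _ = v i

HasFullRowRank : ∀ {m n} → Mat m n → Set
HasFullRowRank {m} {n} A =
  (c : Fin m → ℚ) → (∀ j → sumFin (λ i → c i * A i j) ≡ 0ℚ) → ∀ i → c i ≡ 0ℚ

HasIndependentColumns : ∀ {m k} → Mat m k → Set
HasIndependentColumns {m} {k} A =
  (x : Fin k → ℚ) → (∀ i → sumFin (λ l → A i l * x l) ≡ 0ℚ) → ∀ l → x l ≡ 0ℚ

Invertible : ∀ {n} → Mat n n → Set
Invertible {n} Q = Σ (Mat n n) λ Q' → (Q ⊗ Q' ≈M idM) × (Q' ⊗ Q ≈M idM)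

IsRightInverse : ∀ {p n} → Mat p n → Mat n p → Set
IsRightInverse W W⁺ = W ⊗ W⁺ ≈M idM

IsKernelBasis : ∀ {p n k} → Mat p n → Mat n k → Set
IsKernelBasis {p} {n} {k} W E =
  (W ⊗ E ≈M zeroM)
  × HasIndependentColumns E
  × ((v : Fin n → ℚ) → W ⊗ col v ≈M zeroM → ∃[ x ] (col v ≈M E ⊗ col x))

IsDecomposition : ∀ {t p n} → Mat p n → (Fin t → Mat p n)
                → Mat p n → (Fin t → Fin n → ℚ) → Mat n n → Set
IsDecomposition W₀ W P u Q =
  HasFullRowRank P × Invertible Q × (W₀ ≈M P ⊗ Q)
  × (∀ a → W a ≈M P ⊗ diag (u a) ⊗ Q)

SameTupleSet : ∀ {t n} → (Fin t → Fin n → ℚ) → (Fin t → Fin n → ℚ) → Set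
SameTupleSet {t} {n} u u' =
  (∀ i → ∃[ j ] (∀ a → u a i ≡ u' a j)) × (∀ j → ∃[ i ] (∀ a → u' a j ≡ u a i))

UniqueProblemC : ∀ {t p} (n : ℕ) → Mat p n → (Fin t → Mat p n) → Set
UniqueProblemC {t} {p} n W₀ W =
  (P P' : Mat p n) (Q Q' : Mat n n) (u u' : Fin t → Fin n → ℚ)
  → IsDecomposition W₀ W P u Q → IsDecomposition W₀ W P' u' Q'
  → SameTupleSet u u'

SolvesSystem : ∀ {t p n k} → Mat p n → (Fin t → Mat n n) → Mat n k
             → (Fin t → Mat k n) → Set
SolvesSystem {t} V Y E X =
  ∀ (a b : Fin t) → a Data.Fin.< b →
    (V ⊗ Y a ⊗ Y b ⊖ V ⊗ Y b ⊗ Y a) ≈M (V ⊗ Y b ⊗ E ⊗ X a ⊖ V ⊗ Y a ⊗ E ⊗ X b)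

UniqueSolution : ∀ {t p n k} → Mat p n → (Fin t → Mat n n) → Mat n k → Set
UniqueSolution {t} {p} {n} {k} V Y E =
  Σ (Fin t → Mat k n) (SolvesSystem V Y E)
  × (∀ X X' → SolvesSystem V Y E X → SolvesSystem V Y E X' → ∀ a → X a ≈M X' a)

numEquations : ℕ → ℕ → ℕ → ℕ
numEquations t n p = ((t ℕ.* (t ℕ.∸ 1)) / 2) ℕ.* (n ℕ.* p)

numVariables : ℕ → ℕ → ℕ → ℕ
numVariables t n p = t ℕ.* (n ℕ.∸ p) ℕ.* n

{-# OPTIONS --safe #-}
module Submission where

-- A decomposition W₀ = PQ, W_a = P U_a Q yields commuting matrices M_a = Q⁻¹ U_a Q with
-- W₀ M_a = W_a.  As also W₀ Y_a = W_a, each M_a − Y_a lies columnwise in ker W₀, so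
-- M_a = Y_a + E X_a, and W₀ Y_b M_a = W₀ M_b M_a = W₀ M_a M_b = W₀ Y_a M_b says precisely
-- that X solves the system.  If the solution is unique, any two decompositions have the same
-- M_a, so R = Q′ Q⁻¹ satisfies R U_a = U′_a R; a nonzero entry R_ki of this invertible
-- matrix forces u_{a,i} = u′_{a,k} for every a.

open import Defs
open import Data.Nat using (ℕ; _≤_; _<_; _*_; _+_)
open import Data.Fin using (Fin)
open import Data.Rational using (ℚ)
open import Data.Product using (_×_)

open import Data.Fin using (zero; suc; _≟_; punchIn)
import Data.Fin.Properties as Finₚ
open import Data.Nat using (zero; suc; _∸_; z≤n)
import Data.Nat.Properties as ℕₚ
open import Data.Nat.Divisibility using (_∣_; _∣0; ∣m∣n⇒∣m+n; n∣m*n)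
open import Data.Nat.DivMod using (_/_; m*[n/m]≡n)
import Data.Nat.Solver
open import Data.Product using (Σ; _,_; proj₁; proj₂; ∃-syntax)
open import Data.Rational using (0ℚ; 1ℚ; -_; 1/_; ≢-nonZero)
  renaming (_+_ to _+ℚ_; _*_ to _*ℚ_; _-_ to _-ℚ_)
import Data.Rational.Properties as ℚₚ
import Data.Rational.Solver
open import Relation.Binary.Bundles using (Setoid)
import Relation.Binary.Reasoning.Setoid as SetoidReasoning
open import Function using (_∘_)
open import Relation.Binary.PropositionalEquality
open import Relation.Nullary using (¬_; yes; no; contradiction)

open import Algebra.Bundles using (Ring)
open import Algebra.Properties.Semiring.Sum (Ring.semiring ℚₚ.+-*-ring)
  using (sum; sum-cong-≗; sum-replicate-zero; sum-remove; ∑-distrib-+; ∑-comm; *-distribˡ-sum; *-distribʳ-sum)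
open import Algebra.Properties.Group ℚₚ.+-0-group using (inverseˡ-unique; ∙-cancelʳ)

sumFin≡sum : ∀ {n} (f : Fin n → ℚ) → sumFin f ≡ sum f
sumFin≡sum {zero}  f = refl
sumFin≡sum {suc n} f = cong (f zero +ℚ_) (sumFin≡sum (λ i → f (suc i)))

module _ {n : ℕ} where
  open ≡-Reasoning

  sumFin-cong : {f g : Fin n → ℚ} → (∀ i → f i ≡ g i) → sumFin f ≡ sumFin g
  sumFin-cong {f} {g} f≗g = begin
    sumFin f  ≡⟨ sumFin≡sum f ⟩
    sum f     ≡⟨ sum-cong-≗ f≗g ⟩
    sum g     ≡⟨ sumFin≡sum g ⟨
    sumFin g  ∎

  sumFin-zero : (f : Fin n → ℚ) → (∀ i → f i ≡ 0ℚ) → sumFin f ≡ 0ℚ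
  sumFin-zero f f≗0 = begin
    sumFin f            ≡⟨ sumFin≡sum f ⟩
    sum f               ≡⟨ sum-cong-≗ f≗0 ⟩
    sum {n} (λ _ → 0ℚ)  ≡⟨ sum-replicate-zero n ⟩
    0ℚ                  ∎

  sumFin-+ : (f g : Fin n → ℚ) → sumFin (λ i → f i +ℚ g i) ≡ sumFin f +ℚ sumFin g
  sumFin-+ f g = begin
    sumFin (λ i → f i +ℚ g i)  ≡⟨ sumFin≡sum (λ i → f i +ℚ g i) ⟩
    sum (λ i → f i +ℚ g i)     ≡⟨ ∑-distrib-+ f g ⟩
    sum f +ℚ sum g             ≡⟨ cong₂ _+ℚ_ (sumFin≡sum f) (sumFin≡sum g) ⟨
    sumFin f +ℚ sumFin g       ∎

  sumFin-neg : (f : Fin n → ℚ) → sumFin (λ i → - f i) ≡ - sumFin f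
  sumFin-neg f = inverseˡ-unique _ _ (begin
    sumFin (λ i → - f i) +ℚ sumFin f  ≡⟨ sumFin-+ (λ i → - f i) f ⟨
    sumFin (λ i → - f i +ℚ f i)       ≡⟨ sumFin-zero _ (λ i → ℚₚ.+-inverseˡ (f i)) ⟩
    0ℚ                                ∎)

  sumFin-*ˡ : (c : ℚ) (f : Fin n → ℚ) → sumFin (λ i → c *ℚ f i) ≡ c *ℚ sumFin f
  sumFin-*ˡ c f = begin
    sumFin (λ i → c *ℚ f i)  ≡⟨ sumFin≡sum (λ i → c *ℚ f i) ⟩
    sum (λ i → c *ℚ f i)     ≡⟨ *-distribˡ-sum c f ⟨
    c *ℚ sum f               ≡⟨ cong (c *ℚ_) (sumFin≡sum f) ⟨
    c *ℚ sumFin f            ∎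

  sumFin-*ʳ : (c : ℚ) (f : Fin n → ℚ) → sumFin (λ i → f i *ℚ c) ≡ sumFin f *ℚ c
  sumFin-*ʳ c f = begin
    sumFin (λ i → f i *ℚ c)  ≡⟨ sumFin≡sum (λ i → f i *ℚ c) ⟩
    sum (λ i → f i *ℚ c)     ≡⟨ *-distribʳ-sum c f ⟨
    sum f *ℚ c               ≡⟨ cong (_*ℚ c) (sumFin≡sum f) ⟨
    sumFin f *ℚ c            ∎

  sumFin-comm : ∀ {m} (f : Fin n → Fin m → ℚ) →
    sumFin (λ i → sumFin (f i)) ≡ sumFin (λ j → sumFin (λ i → f i j))
  sumFin-comm f = begin
    sumFin (λ i → sumFin (f i))          ≡⟨ sumFin≡sum (λ i → sumFin (f i)) ⟩
    sum (λ i → sumFin (f i))             ≡⟨ sum-cong-≗ (λ i → sumFin≡sum (f i)) ⟩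
    sum (λ i → sum (f i))                ≡⟨ ∑-comm f ⟩
    sum (λ j → sum (λ i → f i j))        ≡⟨ sum-cong-≗ (λ j → sumFin≡sum (λ i → f i j)) ⟨
    sum (λ j → sumFin (λ i → f i j))     ≡⟨ sumFin≡sum (λ j → sumFin (λ i → f i j)) ⟨
    sumFin (λ j → sumFin (λ i → f i j))  ∎

sumFin-single : ∀ {n} (f : Fin n → ℚ) (i : Fin n) → (∀ l → l ≢ i → f l ≡ 0ℚ) → sumFin f ≡ f i
sumFin-single {suc n} f i vanish = begin
  sumFin f                      ≡⟨ sumFin≡sum f ⟩
  sum f                         ≡⟨ sum-remove f ⟩
  f i +ℚ sum (f ∘ punchIn i)    ≡⟨ cong (f i +ℚ_) (sumFin≡sum (f ∘ punchIn i)) ⟨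
  f i +ℚ sumFin (f ∘ punchIn i) ≡⟨ cong (f i +ℚ_) (sumFin-zero _ (λ l → vanish _ (Finₚ.punchInᵢ≢i i l))) ⟩
  f i +ℚ 0ℚ                     ≡⟨ ℚₚ.+-identityʳ (f i) ⟩
  f i                           ∎
  where open ≡-Reasoning

≈M-refl : ∀ {m n} {A : Mat m n} → A ≈M A
≈M-refl _ _ = refl

≈M-sym : ∀ {m n} {A B : Mat m n} → A ≈M B → B ≈M A
≈M-sym A≈B i j = sym (A≈B i j)

≈M-trans : ∀ {m n} {A B C : Mat m n} → A ≈M B → B ≈M C → A ≈M C
≈M-trans A≈B B≈C i j = trans (A≈B i j) (B≈C i j)

≈M-setoid : ℕ → ℕ → Setoid _ _
≈M-setoid m n = record
  { Carrier       = Mat m n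
  ; _≈_           = _≈M_
  ; isEquivalence = record { refl = ≈M-refl ; sym = ≈M-sym ; trans = ≈M-trans }
  }

module ≈M-Reasoning {m n : ℕ} = SetoidReasoning (≈M-setoid m n)

⊗-congˡ : ∀ {m k n} (A : Mat m k) {B B′ : Mat k n} → B ≈M B′ → A ⊗ B ≈M A ⊗ B′
⊗-congˡ A B≈B′ i j = sumFin-cong (λ l → cong (A i l *ℚ_) (B≈B′ l j))

⊗-congʳ : ∀ {m k n} {A A′ : Mat m k} (B : Mat k n) → A ≈M A′ → A ⊗ B ≈M A′ ⊗ B
⊗-congʳ B A≈A′ i j = sumFin-cong (λ l → cong (_*ℚ B l j) (A≈A′ i l))

⊗-assoc : ∀ {m k l n} (A : Mat m k) (B : Mat k l) (C : Mat l n) → A ⊗ B ⊗ C ≈M A ⊗ (B ⊗ C)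
⊗-assoc A B C i j = begin
  sumFin (λ l → sumFin (λ r → A i r *ℚ B r l) *ℚ C l j)    ≡⟨ sumFin-cong (λ l → sumFin-*ʳ (C l j) (λ r → A i r *ℚ B r l)) ⟨
  sumFin (λ l → sumFin (λ r → A i r *ℚ B r l *ℚ C l j))    ≡⟨ sumFin-comm (λ l r → A i r *ℚ B r l *ℚ C l j) ⟩
  sumFin (λ r → sumFin (λ l → A i r *ℚ B r l *ℚ C l j))    ≡⟨ sumFin-cong (λ r → sumFin-cong (λ l → ℚₚ.*-assoc (A i r) (B r l) (C l j))) ⟩
  sumFin (λ r → sumFin (λ l → A i r *ℚ (B r l *ℚ C l j)))  ≡⟨ sumFin-cong (λ r → sumFin-*ˡ (A i r) (λ l → B r l *ℚ C l j)) ⟩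
  sumFin (λ r → A i r *ℚ sumFin (λ l → B r l *ℚ C l j))    ∎
  where open ≡-Reasoning

⊗-distribˡ-⊖ : ∀ {m k n} (A : Mat m k) (B C : Mat k n) → A ⊗ (B ⊖ C) ≈M A ⊗ B ⊖ A ⊗ C
⊗-distribˡ-⊖ A B C i j = begin
  sumFin (λ l → A i l *ℚ (B l j -ℚ C l j))              ≡⟨ sumFin-cong distrib ⟩
  sumFin (λ l → A i l *ℚ B l j +ℚ - (A i l *ℚ C l j))  ≡⟨ sumFin-+ (λ l → A i l *ℚ B l j) (λ l → - (A i l *ℚ C l j)) ⟩
  (A ⊗ B) i j +ℚ sumFin (λ l → - (A i l *ℚ C l j))     ≡⟨ cong ((A ⊗ B) i j +ℚ_) (sumFin-neg (λ l → A i l *ℚ C l j)) ⟩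
  (A ⊗ B) i j -ℚ (A ⊗ C) i j                            ∎
  where
  open ≡-Reasoning
  distrib : ∀ l → A i l *ℚ (B l j -ℚ C l j) ≡ A i l *ℚ B l j +ℚ - (A i l *ℚ C l j)
  distrib l = trans (ℚₚ.*-distribˡ-+ (A i l) (B l j) (- C l j))
                    (cong (A i l *ℚ B l j +ℚ_) (sym (ℚₚ.neg-distribʳ-* (A i l) (C l j))))

diag-on : ∀ {n} (d : Fin n → ℚ) (i : Fin n) → diag d i i ≡ d i
diag-on d i with i ≟ i
... | yes _   = refl
... | no i≢i  = contradiction refl i≢i

diag-off : ∀ {n} (d : Fin n → ℚ) {i j : Fin n} → i ≢ j → diag d i j ≡ 0ℚ
diag-off d {i} {j} i≢j with i ≟ j
... | yes i≡j = contradiction i≡j i≢j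
... | no _    = refl

idM≈diag-1 : ∀ {n} → idM {n} ≈M diag (λ _ → 1ℚ)
idM≈diag-1 i j with i ≟ j
... | yes _ = refl
... | no _  = refl

diag-⊗ : ∀ {m n} (d : Fin m → ℚ) (A : Mat m n) → diag d ⊗ A ≈M (λ i j → d i *ℚ A i j)
diag-⊗ d A i j = trans (sumFin-single (λ l → diag d i l *ℚ A l j) i off) (cong (_*ℚ A i j) (diag-on d i))
  where
  off : ∀ l → l ≢ i → diag d i l *ℚ A l j ≡ 0ℚ
  off l l≢i = trans (cong (_*ℚ A l j) (diag-off d (l≢i ∘ sym))) (ℚₚ.*-zeroˡ (A l j))

⊗-diag : ∀ {m n} (A : Mat m n) (d : Fin n → ℚ) → A ⊗ diag d ≈M (λ i j → A i j *ℚ d j)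
⊗-diag A d i j = trans (sumFin-single (λ l → A i l *ℚ diag d l j) j off) (cong (A i j *ℚ_) (diag-on d j))
  where
  off : ∀ l → l ≢ j → A i l *ℚ diag d l j ≡ 0ℚ
  off l l≢j = trans (cong (A i l *ℚ_) (diag-off d l≢j)) (ℚₚ.*-zeroʳ (A i l))

⊗-identityˡ : ∀ {m n} (A : Mat m n) → idM ⊗ A ≈M A
⊗-identityˡ A i j = trans (⊗-congʳ A idM≈diag-1 i j) (trans (diag-⊗ _ A i j) (ℚₚ.*-identityˡ (A i j)))

⊗-identityʳ : ∀ {m n} (A : Mat m n) → A ⊗ idM ≈M A
⊗-identityʳ A i j = trans (⊗-congˡ A idM≈diag-1 i j) (trans (⊗-diag A _ i j) (ℚₚ.*-identityʳ (A i j)))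

diag-⊗-comm : ∀ {n} (d e : Fin n → ℚ) → diag d ⊗ diag e ≈M diag e ⊗ diag d
diag-⊗-comm d e i j = begin
  (diag d ⊗ diag e) i j  ≡⟨ diag-⊗ d (diag e) i j ⟩
  d i *ℚ diag e i j      ≡⟨ scale-diag ⟩
  e i *ℚ diag d i j      ≡⟨ diag-⊗ e (diag d) i j ⟨
  (diag e ⊗ diag d) i j  ∎
  where
  open ≡-Reasoning
  scale-diag : d i *ℚ diag e i j ≡ e i *ℚ diag d i j
  scale-diag with i ≟ j
  ... | yes refl = ℚₚ.*-comm (d i) (e i)
  ... | no _     = trans (ℚₚ.*-zeroʳ (d i)) (sym (ℚₚ.*-zeroʳ (e i)))

⊗-cancel-inverseʳ : ∀ {m n} (A : Mat m n) {Q Q⁻ : Mat n n} → Q ⊗ Q⁻ ≈M idM → A ⊗ Q ⊗ Q⁻ ≈M A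
⊗-cancel-inverseʳ A {Q} {Q⁻} QQ⁻≈I = begin
  A ⊗ Q ⊗ Q⁻    ≈⟨ ⊗-assoc A Q Q⁻ ⟩
  A ⊗ (Q ⊗ Q⁻)  ≈⟨ ⊗-congˡ A QQ⁻≈I ⟩
  A ⊗ idM       ≈⟨ ⊗-identityʳ A ⟩
  A             ∎
  where open ≈M-Reasoning

conjugate-⊗ : ∀ {n} {Q Q⁻ : Mat n n} (A : Mat n n) → Q ⊗ Q⁻ ≈M idM → Q ⊗ (Q⁻ ⊗ A ⊗ Q) ≈M A ⊗ Q
conjugate-⊗ {Q = Q} {Q⁻} A QQ⁻≈I = begin
  Q ⊗ (Q⁻ ⊗ A ⊗ Q)  ≈⟨ ⊗-assoc Q (Q⁻ ⊗ A) Q ⟨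
  Q ⊗ (Q⁻ ⊗ A) ⊗ Q  ≈⟨ ⊗-congʳ Q (⊗-assoc Q Q⁻ A) ⟨
  Q ⊗ Q⁻ ⊗ A ⊗ Q    ≈⟨ ⊗-congʳ Q (⊗-congʳ A QQ⁻≈I) ⟩
  idM ⊗ A ⊗ Q       ≈⟨ ⊗-congʳ Q (⊗-identityˡ A) ⟩
  A ⊗ Q             ∎
  where open ≈M-Reasoning

conjugate-⊗-conjugate : ∀ {n} {Q Q⁻ : Mat n n} (A B : Mat n n) → Q ⊗ Q⁻ ≈M idM →
  (Q⁻ ⊗ A ⊗ Q) ⊗ (Q⁻ ⊗ B ⊗ Q) ≈M Q⁻ ⊗ (A ⊗ B) ⊗ Q
conjugate-⊗-conjugate {Q = Q} {Q⁻} A B QQ⁻≈I = begin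
  Q⁻ ⊗ A ⊗ Q ⊗ (Q⁻ ⊗ B ⊗ Q)    ≈⟨ ⊗-assoc (Q⁻ ⊗ A) Q (Q⁻ ⊗ B ⊗ Q) ⟩
  Q⁻ ⊗ A ⊗ (Q ⊗ (Q⁻ ⊗ B ⊗ Q))  ≈⟨ ⊗-congˡ (Q⁻ ⊗ A) (conjugate-⊗ B QQ⁻≈I) ⟩
  Q⁻ ⊗ A ⊗ (B ⊗ Q)              ≈⟨ ⊗-assoc (Q⁻ ⊗ A) B Q ⟨
  Q⁻ ⊗ A ⊗ B ⊗ Q                ≈⟨ ⊗-congʳ Q (⊗-assoc Q⁻ A B) ⟩
  Q⁻ ⊗ (A ⊗ B) ⊗ Q              ∎
  where open ≈M-Reasoning

left-invertible⇒column≢0 : ∀ {m n} {A : Mat m n} {B : Mat n m} → B ⊗ A ≈M idM →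
  ∀ i → ∃[ k ] A k i ≢ 0ℚ
left-invertible⇒column≢0 {m} {A = A} {B} BA≈I i =
  Finₚ.¬∀⟶∃¬ m (λ k → A k i ≡ 0ℚ) (λ k → A k i ℚₚ.≟ 0ℚ) column≢0
  where
  column≢0 : ¬ (∀ k → A k i ≡ 0ℚ)
  column≢0 column≡0 = contradiction 1≡0 λ ()
    where
    open ≡-Reasoning
    1≡0 : 1ℚ ≡ 0ℚ
    1≡0 = begin
      1ℚ                ≡⟨ trans (idM≈diag-1 i i) (diag-on _ i) ⟨
      idM i i           ≡⟨ BA≈I i i ⟨
      (B ⊗ A) i i       ≡⟨ sumFin-zero _ (λ l → trans (cong (B i l *ℚ_) (column≡0 l)) (ℚₚ.*-zeroʳ (B i l))) ⟩
      0ℚ                ∎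

*-cancelʳ-≢0 : ∀ {x y} (z : ℚ) → z ≢ 0ℚ → x *ℚ z ≡ y *ℚ z → x ≡ y
*-cancelʳ-≢0 {x} {y} z z≢0 xz≡yz = begin
  x                  ≡⟨ ℚₚ.*-identityʳ x ⟨
  x *ℚ 1ℚ            ≡⟨ cong (x *ℚ_) (ℚₚ.*-inverseʳ z) ⟨
  x *ℚ (z *ℚ 1/ z)   ≡⟨ ℚₚ.*-assoc x z (1/ z) ⟨
  x *ℚ z *ℚ 1/ z     ≡⟨ cong (_*ℚ 1/ z) xz≡yz ⟩
  y *ℚ z *ℚ 1/ z     ≡⟨ ℚₚ.*-assoc y z (1/ z) ⟩
  y *ℚ (z *ℚ 1/ z)   ≡⟨ cong (y *ℚ_) (ℚₚ.*-inverseʳ z) ⟩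
  y *ℚ 1ℚ            ≡⟨ ℚₚ.*-identityʳ y ⟩
  y                  ∎
  where
  open ≡-Reasoning
  instance _ = ≢-nonZero z≢0

intertwined-diag⇒eigenvalue : ∀ {n} {R : Mat n n} {d e : Fin n → ℚ} →
  R ⊗ diag d ≈M diag e ⊗ R → ∀ {k i} → R k i ≢ 0ℚ → d i ≡ e k
intertwined-diag⇒eigenvalue {R = R} {d} {e} RD≈ER {k} {i} Rki≢0 = *-cancelʳ-≢0 (R k i) Rki≢0 (begin
  d i *ℚ R k i         ≡⟨ ℚₚ.*-comm (d i) (R k i) ⟩
  R k i *ℚ d i         ≡⟨ ⊗-diag R d k i ⟨
  (R ⊗ diag d) k i     ≡⟨ RD≈ER k i ⟩
  (diag e ⊗ R) k i     ≡⟨ diag-⊗ e R k i ⟩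
  e k *ℚ R k i         ∎)
  where open ≡-Reasoning

similar-diagonals⇒tuple∈ : ∀ {t n} {Q Q⁻ Q′ Q′⁻ : Mat n n} {u u′ : Fin t → Fin n → ℚ} →
  Q ⊗ Q⁻ ≈M idM → Q′ ⊗ Q′⁻ ≈M idM → Q′⁻ ⊗ Q′ ≈M idM →
  (∀ a → Q⁻ ⊗ diag (u a) ⊗ Q ≈M Q′⁻ ⊗ diag (u′ a) ⊗ Q′) →
  ∀ i → ∃[ k ] (∀ a → u a i ≡ u′ a k)
similar-diagonals⇒tuple∈ {Q = Q} {Q⁻} {Q′} {Q′⁻} {u} {u′} QQ⁻≈I Q′Q′⁻≈I Q′⁻Q′≈I similar i =
  let k , Rki≢0 = left-invertible⇒column≢0 {A = R} {B = Q ⊗ Q′⁻} R-left-invertible i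
  in  k , λ a → intertwined-diag⇒eigenvalue (intertwines a) Rki≢0
  where
  open ≈M-Reasoning
  R : Mat _ _
  R = Q′ ⊗ Q⁻

  R-left-invertible : Q ⊗ Q′⁻ ⊗ R ≈M idM
  R-left-invertible = begin
    Q ⊗ Q′⁻ ⊗ (Q′ ⊗ Q⁻)  ≈⟨ ⊗-assoc (Q ⊗ Q′⁻) Q′ Q⁻ ⟨
    Q ⊗ Q′⁻ ⊗ Q′ ⊗ Q⁻    ≈⟨ ⊗-congʳ Q⁻ (⊗-cancel-inverseʳ Q Q′⁻Q′≈I) ⟩
    Q ⊗ Q⁻               ≈⟨ QQ⁻≈I ⟩
    idM                  ∎

  intertwines : ∀ a → R ⊗ diag (u a) ≈M diag (u′ a) ⊗ R
  intertwines a = begin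
    Q′ ⊗ Q⁻ ⊗ D                ≈⟨ ⊗-cancel-inverseʳ (Q′ ⊗ Q⁻ ⊗ D) QQ⁻≈I ⟨
    Q′ ⊗ Q⁻ ⊗ D ⊗ Q ⊗ Q⁻       ≈⟨ ⊗-congʳ Q⁻ (⊗-congʳ Q (⊗-assoc Q′ Q⁻ D)) ⟩
    Q′ ⊗ (Q⁻ ⊗ D) ⊗ Q ⊗ Q⁻     ≈⟨ ⊗-congʳ Q⁻ (⊗-assoc Q′ (Q⁻ ⊗ D) Q) ⟩
    Q′ ⊗ (Q⁻ ⊗ D ⊗ Q) ⊗ Q⁻     ≈⟨ ⊗-congʳ Q⁻ (⊗-congˡ Q′ (similar a)) ⟩
    Q′ ⊗ (Q′⁻ ⊗ D′ ⊗ Q′) ⊗ Q⁻  ≈⟨ ⊗-congʳ Q⁻ (conjugate-⊗ D′ Q′Q′⁻≈I) ⟩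
    D′ ⊗ Q′ ⊗ Q⁻               ≈⟨ ⊗-assoc D′ Q′ Q⁻ ⟩
    D′ ⊗ (Q′ ⊗ Q⁻)             ∎
    where
    D D′ : Mat _ _
    D  = diag (u a)
    D′ = diag (u′ a)

similar-diagonals⇒SameTupleSet : ∀ {t n} {Q Q′ : Mat n n} {u u′ : Fin t → Fin n → ℚ} →
  ((Q⁻ , _) : Invertible Q) ((Q′⁻ , _) : Invertible Q′) →
  (∀ a → Q⁻ ⊗ diag (u a) ⊗ Q ≈M Q′⁻ ⊗ diag (u′ a) ⊗ Q′) → SameTupleSet u u′
similar-diagonals⇒SameTupleSet (_ , QQ⁻≈I , Q⁻Q≈I) (_ , Q′Q′⁻≈I , Q′⁻Q′≈I) similar =
    similar-diagonals⇒tuple∈ QQ⁻≈I Q′Q′⁻≈I Q′⁻Q′≈I similar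
  , similar-diagonals⇒tuple∈ Q′Q′⁻≈I QQ⁻≈I Q⁻Q≈I (λ a → ≈M-sym (similar a))

⊗-right-inverse : ∀ {p n m} {W : Mat p n} {W⁺ : Mat n p} → IsRightInverse W W⁺ →
  (A : Mat p m) → W ⊗ (W⁺ ⊗ A) ≈M A
⊗-right-inverse {W = W} {W⁺} WW⁺≈I A = begin
  W ⊗ (W⁺ ⊗ A)  ≈⟨ ⊗-assoc W W⁺ A ⟨
  W ⊗ W⁺ ⊗ A    ≈⟨ ⊗-congʳ A WW⁺≈I ⟩
  idM ⊗ A       ≈⟨ ⊗-identityˡ A ⟩
  A             ∎
  where open ≈M-Reasoning

⊗-⊖-≈zeroM : ∀ {m k n} {A : Mat m k} {B B′ : Mat k n} {C : Mat m n} →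
  A ⊗ B ≈M C → A ⊗ B′ ≈M C → A ⊗ (B ⊖ B′) ≈M zeroM
⊗-⊖-≈zeroM {A = A} {B} {B′} {C} AB≈C AB′≈C i j = begin
  (A ⊗ (B ⊖ B′)) i j          ≡⟨ ⊗-distribˡ-⊖ A B B′ i j ⟩
  (A ⊗ B) i j -ℚ (A ⊗ B′) i j  ≡⟨ cong₂ _-ℚ_ (AB≈C i j) (AB′≈C i j) ⟩
  C i j -ℚ C i j              ≡⟨ ℚₚ.+-inverseʳ (C i j) ⟩
  0ℚ                          ∎
  where open ≡-Reasoning

IsKernelBasis⇒factor : ∀ {p n k m} {W : Mat p n} {E : Mat n k} → IsKernelBasis W E →
  (A : Mat n m) → W ⊗ A ≈M zeroM → Σ (Mat k m) λ X → A ≈M E ⊗ X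
IsKernelBasis⇒factor {E = E} (_ , _ , spans) A WA≈0 =
  (λ l j → proj₁ (column j) l) , (λ i j → proj₂ (column j) i zero)
  where
  column : ∀ j → ∃[ x ] (col (λ l → A l j) ≈M E ⊗ col x)
  column j = spans (λ l → A l j) (λ i _ → WA≈0 i j)

commuting-lift⇒SolvesSystem : ∀ {t p n k} {V : Mat p n} {Y M : Fin t → Mat n n} {E : Mat n k}
  {X : Fin t → Mat k n} →
  (∀ a → V ⊗ Y a ≈M V ⊗ M a) → (∀ a b → M a ⊗ M b ≈M M b ⊗ M a) →
  (∀ a → M a ⊖ Y a ≈M E ⊗ X a) → SolvesSystem V Y E X
commuting-lift⇒SolvesSystem {V = V} {Y} {M} {E} {X} VY≈VM M-comm M-Y≈EX a b _ i j =
  trans (difference-of-differences A B x)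
        (sym (cong₂ _-ℚ_ (expand a b i j) (trans (expand b a i j) (cong (_-ℚ A) (sym (swap a b i j))))))
  where
  A = (V ⊗ Y a ⊗ Y b) i j
  B = (V ⊗ Y b ⊗ Y a) i j
  x = (V ⊗ Y b ⊗ M a) i j

  difference-of-differences : ∀ A B x → A -ℚ B ≡ (x -ℚ B) -ℚ (x -ℚ A)
  difference-of-differences = solve 3 (λ A B x → A :- B := (x :- B) :- (x :- A)) refl
    where open Data.Rational.Solver.+-*-Solver

  expand : ∀ c d → V ⊗ Y d ⊗ E ⊗ X c ≈M V ⊗ Y d ⊗ M c ⊖ V ⊗ Y d ⊗ Y c
  expand c d = begin
    V ⊗ Y d ⊗ E ⊗ X c      ≈⟨ ⊗-assoc (V ⊗ Y d) E (X c) ⟩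
    V ⊗ Y d ⊗ (E ⊗ X c)    ≈⟨ ⊗-congˡ (V ⊗ Y d) (M-Y≈EX c) ⟨
    V ⊗ Y d ⊗ (M c ⊖ Y c)  ≈⟨ ⊗-distribˡ-⊖ (V ⊗ Y d) (M c) (Y c) ⟩
    V ⊗ Y d ⊗ M c ⊖ V ⊗ Y d ⊗ Y c ∎
    where open ≈M-Reasoning

  swap : ∀ c d → V ⊗ Y d ⊗ M c ≈M V ⊗ Y c ⊗ M d
  swap c d = begin
    V ⊗ Y d ⊗ M c    ≈⟨ ⊗-congʳ (M c) (VY≈VM d) ⟩
    V ⊗ M d ⊗ M c    ≈⟨ ⊗-assoc V (M d) (M c) ⟩
    V ⊗ (M d ⊗ M c)  ≈⟨ ⊗-congˡ V (M-comm d c) ⟩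
    V ⊗ (M c ⊗ M d)  ≈⟨ ⊗-assoc V (M c) (M d) ⟨
    V ⊗ M c ⊗ M d    ≈⟨ ⊗-congʳ (M d) (VY≈VM c) ⟨
    V ⊗ Y c ⊗ M d    ∎
    where open ≈M-Reasoning

module _ {t p n} {W₀ : Mat p n} {W : Fin t → Mat p n} {P : Mat p n} {u : Fin t → Fin n → ℚ}
         {Q : Mat n n} where

  diagonal-lift : IsDecomposition W₀ W P u Q → Fin t → Mat n n
  diagonal-lift (_ , (Q⁻ , _) , _) a = Q⁻ ⊗ diag (u a) ⊗ Q

  diagonal-lift-lifts : (dec : IsDecomposition W₀ W P u Q) → ∀ a → W₀ ⊗ diagonal-lift dec a ≈M W a
  diagonal-lift-lifts (_ , (Q⁻ , QQ⁻≈I , _) , W₀≈PQ , W≈PDQ) a = begin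
    W₀ ⊗ (Q⁻ ⊗ D ⊗ Q)       ≈⟨ ⊗-congʳ (Q⁻ ⊗ D ⊗ Q) W₀≈PQ ⟩
    P ⊗ Q ⊗ (Q⁻ ⊗ D ⊗ Q)    ≈⟨ ⊗-assoc P Q (Q⁻ ⊗ D ⊗ Q) ⟩
    P ⊗ (Q ⊗ (Q⁻ ⊗ D ⊗ Q))  ≈⟨ ⊗-congˡ P (conjugate-⊗ D QQ⁻≈I) ⟩
    P ⊗ (D ⊗ Q)             ≈⟨ ⊗-assoc P D Q ⟨
    P ⊗ D ⊗ Q               ≈⟨ W≈PDQ a ⟨
    W a                     ∎
    where
    open ≈M-Reasoning
    D : Mat n n
    D = diag (u a)

  diagonal-lifts-commute : (dec : IsDecomposition W₀ W P u Q) →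
    ∀ a b → diagonal-lift dec a ⊗ diagonal-lift dec b ≈M diagonal-lift dec b ⊗ diagonal-lift dec a
  diagonal-lifts-commute (_ , (Q⁻ , QQ⁻≈I , _) , _) a b = begin
    Q⁻ ⊗ diag (u a) ⊗ Q ⊗ (Q⁻ ⊗ diag (u b) ⊗ Q)  ≈⟨ conjugate-⊗-conjugate (diag (u a)) (diag (u b)) QQ⁻≈I ⟩
    Q⁻ ⊗ (diag (u a) ⊗ diag (u b)) ⊗ Q           ≈⟨ ⊗-congʳ Q (⊗-congˡ Q⁻ (diag-⊗-comm (u a) (u b))) ⟩
    Q⁻ ⊗ (diag (u b) ⊗ diag (u a)) ⊗ Q           ≈⟨ conjugate-⊗-conjugate (diag (u b)) (diag (u a)) QQ⁻≈I ⟨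
    Q⁻ ⊗ diag (u b) ⊗ Q ⊗ (Q⁻ ⊗ diag (u a) ⊗ Q)  ∎
    where open ≈M-Reasoning

decomposition⇒solution : ∀ {t p n k} {W₀ : Mat p n} {W : Fin t → Mat p n} {E : Mat n k}
  {W₀⁺ : Mat n p} {P : Mat p n} {u : Fin t → Fin n → ℚ} {Q : Mat n n} →
  IsKernelBasis W₀ E → IsRightInverse W₀ W₀⁺ → (dec : IsDecomposition W₀ W P u Q) →
  Σ (Fin t → Mat k n) λ X →
    SolvesSystem W₀ (λ a → W₀⁺ ⊗ W a) E X × (∀ a → diagonal-lift dec a ⊖ W₀⁺ ⊗ W a ≈M E ⊗ X a)
decomposition⇒solution {t} {k = k} {W₀} {W} {E} {W₀⁺} kernel W₀W₀⁺≈I dec =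
  X , commuting-lift⇒SolvesSystem {V = W₀} {M = diagonal-lift dec} {E} W₀Y≈W₀M (diagonal-lifts-commute dec) M-Y≈EX , M-Y≈EX
  where
  W₀Y≈W : ∀ a → W₀ ⊗ (W₀⁺ ⊗ W a) ≈M W a
  W₀Y≈W a = ⊗-right-inverse {W = W₀} {W₀⁺} W₀W₀⁺≈I (W a)

  W₀Y≈W₀M : ∀ a → W₀ ⊗ (W₀⁺ ⊗ W a) ≈M W₀ ⊗ diagonal-lift dec a
  W₀Y≈W₀M a = ≈M-trans (W₀Y≈W a) (≈M-sym (diagonal-lift-lifts dec a))

  factor : ∀ a → Σ _ λ Xₐ → diagonal-lift dec a ⊖ W₀⁺ ⊗ W a ≈M E ⊗ Xₐ
  factor a = IsKernelBasis⇒factor {W = W₀} kernel (diagonal-lift dec a ⊖ W₀⁺ ⊗ W a) (⊗-⊖-≈zeroM {A = W₀} (diagonal-lift-lifts dec a) (W₀Y≈W a))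

  X : Fin t → Mat k _
  X a = proj₁ (factor a)

  M-Y≈EX : ∀ a → diagonal-lift dec a ⊖ W₀⁺ ⊗ W a ≈M E ⊗ X a
  M-Y≈EX a = proj₂ (factor a)

UniqueSolution⇒UniqueProblemC : ∀ {t p n k} {W₀ : Mat p n} {W : Fin t → Mat p n} {E : Mat n k}
  {W₀⁺ : Mat n p} → IsKernelBasis W₀ E → IsRightInverse W₀ W₀⁺ →
  UniqueSolution W₀ (λ a → W₀⁺ ⊗ W a) E → UniqueProblemC n W₀ W
UniqueSolution⇒UniqueProblemC {W₀ = W₀} {W} {E} {W₀⁺} kernel W₀W₀⁺≈I (_ , unique) _ _ _ _ _ _ dec dec′ =
  similar-diagonals⇒SameTupleSet (proj₁ (proj₂ dec)) (proj₁ (proj₂ dec′)) lifts-agree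
  where
  solution = decomposition⇒solution {W₀ = W₀} {W} {E} {W₀⁺} kernel W₀W₀⁺≈I dec
  solution′ = decomposition⇒solution {W₀ = W₀} {W} {E} {W₀⁺} kernel W₀W₀⁺≈I dec′

  lifts-agree : ∀ a → diagonal-lift dec a ≈M diagonal-lift dec′ a
  lifts-agree a i j = ∙-cancelʳ (- (W₀⁺ ⊗ W a) i j) _ _ (begin
    (diagonal-lift dec a ⊖ W₀⁺ ⊗ W a) i j   ≡⟨ proj₂ (proj₂ solution) a i j ⟩
    (E ⊗ proj₁ solution a) i j             ≡⟨ ⊗-congˡ E same-solution i j ⟩
    (E ⊗ proj₁ solution′ a) i j            ≡⟨ proj₂ (proj₂ solution′) a i j ⟨
    (diagonal-lift dec′ a ⊖ W₀⁺ ⊗ W a) i j  ∎)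
    where
    open ≡-Reasoning
    same-solution : proj₁ solution a ≈M proj₁ solution′ a
    same-solution = unique _ _ (proj₁ (proj₂ solution)) (proj₁ (proj₂ solution′)) a

2∣suc[n]*n : ∀ n → 2 ∣ suc n * n
2∣suc[n]*n zero    = 2 ∣0
2∣suc[n]*n (suc n) = subst (2 ∣_) split (∣m∣n⇒∣m+n (n∣m*n (suc n)) (2∣suc[n]*n n))
  where
  split : suc n * 2 + suc n * n ≡ suc (suc n) * suc n
  split = trans (sym (ℕₚ.*-distribˡ-+ (suc n) 2 n)) (ℕₚ.*-comm (suc n) (suc (suc n)))

numVariables≤numEquations : ∀ n t p → 2 * n ≤ p * (t + 1) → numVariables t n p ≤ numEquations t n p
numVariables≤numEquations n zero    p _        = z≤n
numVariables≤numEquations n (suc m) p 2n≤p[t+1] = ℕₚ.*-cancelˡ-≤ 2 (begin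
  2 * (suc m * (n ∸ p) * n)        ≡⟨ rearrange₁ (suc m) (n ∸ p) n ⟩
  suc m * (2 * (n ∸ p)) * n        ≤⟨ ℕₚ.*-monoˡ-≤ n (ℕₚ.*-monoʳ-≤ (suc m) 2[n∸p]≤m*p) ⟩
  suc m * (m * p) * n              ≡⟨ rearrange₂ (suc m) m p n ⟩
  suc m * m * (n * p)              ≡⟨ cong (_* (n * p)) (m*[n/m]≡n (2∣suc[n]*n m)) ⟨
  2 * (suc m * m / 2) * (n * p)    ≡⟨ ℕₚ.*-assoc 2 (suc m * m / 2) (n * p) ⟩
  2 * numEquations (suc m) n p     ∎)
  where
  open ℕₚ.≤-Reasoning
  open Data.Nat.Solver.+-*-Solver

  rearrange₁ : ∀ s d n → 2 * (s * d * n) ≡ s * (2 * d) * n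
  rearrange₁ = solve 3 (λ s d n → con 2 :* (s :* d :* n) := s :* (con 2 :* d) :* n) refl

  rearrange₂ : ∀ s m p n → s * (m * p) * n ≡ s * m * (n * p)
  rearrange₂ = solve 4 (λ s m p n → s :* (m :* p) :* n := s :* m :* (n :* p)) refl

  p[m+2]≡m*p+2*p : p * (suc m + 1) ≡ m * p + 2 * p
  p[m+2]≡m*p+2*p = solve 2 (λ m p → p :* ((con 1 :+ m) :+ con 1) := m :* p :+ con 2 :* p) refl m p

  2[n∸p]≤m*p : 2 * (n ∸ p) ≤ m * p
  2[n∸p]≤m*p = begin
    2 * (n ∸ p)                  ≡⟨ ℕₚ.*-distribˡ-∸ 2 n p ⟩
    2 * n ∸ 2 * p                ≤⟨ ℕₚ.∸-monoˡ-≤ (2 * p) 2n≤p[t+1] ⟩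
    p * (suc m + 1) ∸ 2 * p      ≡⟨ cong (_∸ 2 * p) p[m+2]≡m*p+2*p ⟩
    m * p + 2 * p ∸ 2 * p        ≡⟨ ℕₚ.m+n∸n≡m (m * p) (2 * p) ⟩
    m * p                        ∎

proposition3p3 : (n t p : ℕ) → 2 ≤ n → 2 ≤ t → 2 ≤ p → p < n →
    ((u : Fin t → Fin n → ℚ) (P : Mat p n) (Q : Mat n n) →
      HasFullRowRank P → Invertible Q →
      (E : Mat n (n Data.Nat.∸ p)) (W₀⁺ : Mat n p) →
      IsKernelBasis (P ⊗ Q) E → IsRightInverse (P ⊗ Q) W₀⁺ →
      UniqueSolution (P ⊗ Q) (λ a → W₀⁺ ⊗ (P ⊗ diag (u a) ⊗ Q)) E →
      UniqueProblemC n (P ⊗ Q) (λ a → P ⊗ diag (u a) ⊗ Q))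
    × (2 * n ≤ p * (t + 1) → numVariables t n p ≤ numEquations t n p)
proposition3p3 n t p _ _ _ _ =
    (λ u P Q _ _ E W₀⁺ kernel right-inverse unique →
       UniqueSolution⇒UniqueProblemC {W₀ = P ⊗ Q} {λ a → P ⊗ diag (u a) ⊗ Q} {E} {W₀⁺}
         kernel right-inverse unique)
  , numVariables≤numEquations n t p
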